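{- In every c-trioid, with $d(x)=(x\cdot 1_\pi)\|1_\sigma$, the following hold for all $x,y$: $x\le d(x)\cdot x$; $d(x\cdot d(y))=d(x\cdot y)$; $d(x\|y)=d(x)\|d(y)$; $d(x)\|d(y)=d(x)\cdot d(y)$; $d(x+y)=d(x)+d(y)$; $d(x)\le 1_\sigma$; $d(0)=0$.
   Context: A proto-dioid is $(S,+,\cdot,0,1_\sigma)$ where $(S,+,0)$ is a (join) semilattice with least element $0$ (order $x\le y\iff x+y=y$), $1_\sigma\cdot x=x=x\cdot 1_\sigma$, and $x\cdot y+x\cdot z\le x\cdot(y+z)$, $(x+y)\cdot z=x\cdot z+y\cdot z$, $0\cdot x=0$. A commutative dioid $(S,+,\|,0,1_\pi)$: $(S,+,0)$ as before, $\|$ associative and commutative with unit $1_\pi$, distributing over $+$, with $0\|x=0$. A proto-trioid is $(S,+,\cdot,\|,0,1_\sigma,1_\pi)$ such that $(S,+,\cdot,0,1_\sigma)$ is a proto-dioid and $(S,+,\|,0,1_\pi)$ a commutative dioid. A c-trioid is a proto-trioid satisfying for all $x,y$: (c1) $(x\cdot 1_\pi)\|x=x$; (c2) $((x\cdot 1_\pi)\|1_\sigma)\cdot y=(x\cdot 1_\pi)\|y$; (c3) $(x\|y)\cdot 1_\pi=(x\cdot 1_\pi)\|(y\cdot 1_\pi)$; (c4) $(x\cdot y)\cdot 1_\pi=x\cdot(y\cdot 1_\pi)$; (c5) $1_\sigma\|1_\sigma=1_\sigma$; (c6) $x\cdot 1_\pi\le 1_\pi$. -}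

module Defs where

open import Level using (Level; suc; _⊔_)
open import Relation.Binary.PropositionalEquality using (_≡_)

record CTrioid (a : Level) : Set (suc a) where
  infixl 6 _+_
  infixl 7 _·_
  infixl 7 _∥_
  infix 4 _≤_
  field
    Carrier : Set a
    _+_ _·_ _∥_ : Carrier → Carrier → Carrier
    𝟘 1σ 1π : Carrier

  _≤_ : Carrier → Carrier → Set a
  x ≤ y = x + y ≡ y

  field
    +-assoc : ∀ x y z → (x + y) + z ≡ x + (y + z)
    +-comm  : ∀ x y → x + y ≡ y + x
    +-idem  : ∀ x → x + x ≡ x
    +-identityˡ : ∀ x → 𝟘 + x ≡ x
    ·-identityˡ : ∀ x → 1σ · x ≡ x
    ·-identityʳ : ∀ x → x · 1σ ≡ x
    ·-subdistribˡ : ∀ x y z → x · y + x · z ≤ x · (y + z)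
    ·-distribʳ : ∀ x y z → (x + y) · z ≡ x · z + y · z
    ·-zeroˡ : ∀ x → 𝟘 · x ≡ 𝟘
    ∥-assoc : ∀ x y z → (x ∥ y) ∥ z ≡ x ∥ (y ∥ z)
    ∥-comm  : ∀ x y → x ∥ y ≡ y ∥ x
    ∥-identityˡ : ∀ x → 1π ∥ x ≡ x
    ∥-distribˡ : ∀ x y z → x ∥ (y + z) ≡ x ∥ y + x ∥ z
    ∥-zeroˡ : ∀ x → 𝟘 ∥ x ≡ 𝟘
    c1 : ∀ x → (x · 1π) ∥ x ≡ x
    c2 : ∀ x y → ((x · 1π) ∥ 1σ) · y ≡ (x · 1π) ∥ y
    c3 : ∀ x y → (x ∥ y) · 1π ≡ (x · 1π) ∥ (y · 1π)
    c4 : ∀ x y → (x · y) · 1π ≡ x · (y · 1π)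
    c5 : 1σ ∥ 1σ ≡ 1σ
    c6 : ∀ x → x · 1π ≤ 1π

  d : Carrier → Carrier
  d x = (x · 1π) ∥ 1σ

module Submission where

open import Defs
open import Level using (Level)
open import Relation.Binary.PropositionalEquality
  using (_≡_; sym; trans; cong; cong₂; module ≡-Reasoning)
open import Data.Product using (_×_; _,_)

module CTrioidProperties {a : Level} (T : CTrioid a) where
  open CTrioid T
  open ≡-Reasoning

  -- _·_ and _∥_ share precedence infixl 7, hence the explicit parentheses below.

  ∥-distribʳ : ∀ x y z → (x + y) ∥ z ≡ x ∥ z + y ∥ z
  ∥-distribʳ x y z = begin
    (x + y) ∥ z     ≡⟨ ∥-comm (x + y) z ⟩
    z ∥ (x + y)     ≡⟨ ∥-distribˡ z x y ⟩
    z ∥ x + z ∥ y   ≡⟨ cong₂ _+_ (∥-comm z x) (∥-comm z y) ⟩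
    x ∥ z + y ∥ z   ∎

  ∥-identityʳ : ∀ x → x ∥ 1π ≡ x
  ∥-identityʳ x = trans (∥-comm x 1π) (∥-identityˡ x)

  1σ∥-absorbs-∥1σ : ∀ x → 1σ ∥ (x ∥ 1σ) ≡ x ∥ 1σ
  1σ∥-absorbs-∥1σ x = begin
    1σ ∥ (x ∥ 1σ)   ≡⟨ cong (1σ ∥_) (∥-comm x 1σ) ⟩
    1σ ∥ (1σ ∥ x)   ≡⟨ sym (∥-assoc 1σ 1σ x) ⟩
    (1σ ∥ 1σ) ∥ x   ≡⟨ cong (_∥ x) c5 ⟩
    1σ ∥ x          ≡⟨ ∥-comm 1σ x ⟩
    x ∥ 1σ          ∎

  d∥d≡[x·1π∥y·1π]∥1σ : ∀ x y → d x ∥ d y ≡ ((x · 1π) ∥ (y · 1π)) ∥ 1σ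
  d∥d≡[x·1π∥y·1π]∥1σ x y = begin
    ((x · 1π) ∥ 1σ) ∥ ((y · 1π) ∥ 1σ)   ≡⟨ ∥-assoc (x · 1π) 1σ (d y) ⟩
    (x · 1π) ∥ (1σ ∥ ((y · 1π) ∥ 1σ))   ≡⟨ cong ((x · 1π) ∥_) (1σ∥-absorbs-∥1σ (y · 1π)) ⟩
    (x · 1π) ∥ ((y · 1π) ∥ 1σ)          ≡⟨ sym (∥-assoc (x · 1π) (y · 1π) 1σ) ⟩
    ((x · 1π) ∥ (y · 1π)) ∥ 1σ          ∎

  d·1π≡·1π : ∀ x → d x · 1π ≡ x · 1π
  d·1π≡·1π x = trans (c2 x 1π) (∥-identityʳ (x · 1π))

  d·x≡x : ∀ x → d x · x ≡ x
  d·x≡x x = trans (c2 x x) (c1 x)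

  x≤d·x : ∀ x → x ≤ d x · x
  x≤d·x x = begin
    x + d x · x   ≡⟨ cong (x +_) (d·x≡x x) ⟩
    x + x         ≡⟨ +-idem x ⟩
    x             ≡⟨ sym (d·x≡x x) ⟩
    d x · x       ∎

  d[x·d]≡d[x·] : ∀ x y → d (x · d y) ≡ d (x · y)
  d[x·d]≡d[x·] x y = cong (_∥ 1σ) (begin
    (x · d y) · 1π   ≡⟨ c4 x (d y) ⟩
    x · (d y · 1π)   ≡⟨ cong (x ·_) (d·1π≡·1π y) ⟩
    x · (y · 1π)     ≡⟨ sym (c4 x y) ⟩
    (x · y) · 1π     ∎)

  d-homo-∥ : ∀ x y → d (x ∥ y) ≡ d x ∥ d y
  d-homo-∥ x y = trans (cong (_∥ 1σ) (c3 x y)) (sym (d∥d≡[x·1π∥y·1π]∥1σ x y))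

  d∥d≡d·d : ∀ x y → d x ∥ d y ≡ d x · d y
  d∥d≡d·d x y = begin
    d x ∥ d y                  ≡⟨ d∥d≡[x·1π∥y·1π]∥1σ x y ⟩
    ((x · 1π) ∥ (y · 1π)) ∥ 1σ ≡⟨ ∥-assoc (x · 1π) (y · 1π) 1σ ⟩
    (x · 1π) ∥ d y             ≡⟨ sym (c2 x (d y)) ⟩
    d x · d y                  ∎

  d-homo-+ : ∀ x y → d (x + y) ≡ d x + d y
  d-homo-+ x y = trans (cong (_∥ 1σ) (·-distribʳ x y 1π)) (∥-distribʳ (x · 1π) (y · 1π) 1σ)

  d≤1σ : ∀ x → d x ≤ 1σ
  d≤1σ x = sym (begin
    1σ                           ≡⟨ sym (∥-identityˡ 1σ) ⟩
    1π ∥ 1σ                      ≡⟨ cong (_∥ 1σ) (sym (c6 x)) ⟩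
    (x · 1π + 1π) ∥ 1σ           ≡⟨ ∥-distribʳ (x · 1π) 1π 1σ ⟩
    d x + 1π ∥ 1σ                ≡⟨ cong (d x +_) (∥-identityˡ 1σ) ⟩
    d x + 1σ                     ∎)

  d-zero : d 𝟘 ≡ 𝟘
  d-zero = trans (cong (_∥ 1σ) (·-zeroˡ 1π)) (∥-zeroˡ 1σ)

proposition14 : ∀ {a : Level} (T : CTrioid a) → let open CTrioid T in
    (∀ x → x ≤ d x · x)
    × (∀ x y → d (x · d y) ≡ d (x · y))
    × (∀ x y → d (x ∥ y) ≡ d x ∥ d y)
    × (∀ x y → d x ∥ d y ≡ d x · d y)
    × (∀ x y → d (x + y) ≡ d x + d y)
    × (∀ x → d x ≤ 1σ)
    × (d 𝟘 ≡ 𝟘)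
proposition14 T =
  x≤d·x , d[x·d]≡d[x·] , d-homo-∥ , d∥d≡d·d , d-homo-+ , d≤1σ , d-zero
  where open CTrioidProperties T
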